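{- Let an Isolation instance be given with scenario index set $M$ and scenario probabilities $\{q_i\}_{i\in M}$ summing to $1$, and let $P_1,\dots,P_t$ be any partition of $M$, with $q'_k=\sum_{i\in P_k}q_i>0$ for each $k$. For each $k$ let $\mathcal{J}_k$ be the Isolation instance on the same metric and root with scenarios $\{S_i\}_{i\in P_k}$ and probabilities $\{q_i/q'_k\}_{i\in P_k}$, and let $\mathcal{J}_0$ be the original instance. Then $$\sum_{k=1}^t q'_k\cdot \mathrm{IsoTime}^*(\mathcal{J}_k)\le \mathrm{IsoTime}^*(\mathcal{J}_0),$$ where $\mathrm{IsoTime}^*$ denotes the optimal value of an Isolation instance.
   Context: Isolation problem: input is a finite metric $(V,d)$, a root $r\in V$, and distinct subsets (scenarios) $S_i\subseteq V$, $i\in M$, with probabilities $q_i$ summing to $1$. A decision tree in $(V,d)$ is a rooted binary tree in which each non-leaf node is labeled by a vertex $u\in V$ and has a "yes" child (taken if there is demand at $u$) and a "no" child (taken otherwise); for a realized demand set $D$ this gives a unique root-to-leaf path $P_D$. Its length $d(P_D)$ is the length of the closed tour starting at $r$, visiting the labels of $P_D$ in order, and returning to $r$. A feasible solution is a decision tree with root labeled $r$ such that the paths $P_{S_i}$, $i\in M$, end at pairwise distinct leaves; its cost is $\sum_{i\in M} q_i\, d(P_{S_i})$, and $\mathrm{IsoTime}^*$ is the minimum cost.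
   Formalization: The distances $d$ and the scenario probabilities $q_i$ take rational values. -}

module Defs where

open import Data.Nat using (ℕ)
open import Data.Bool using (Bool; true; false; if_then_else_)
open import Data.Fin using (Fin; zero; suc)
open import Data.Fin.Subset using (Subset)
open import Data.Vec using (lookup)
open import Data.List using (List; []; _∷_; filter; length)
import Data.List as L
open import Data.Product using (_×_; _,_; proj₁; proj₂; Σ)
open import Data.Rational using (ℚ; 0ℚ; 1ℚ; _+_; _*_; _≤_; _<_; 1/_; positive)
open import Data.Rational.Properties using (pos⇒nonZero)
open import Relation.Binary.PropositionalEquality using (_≡_; _≢_)
open import Relation.Nullary.Decidable using (⌊_⌋)
open import Function.Definitions using (Injective)
import Data.Fin as F

sumF : ∀ {m} → (Fin m → ℚ) → ℚ
sumF {ℕ.zero}  f = 0ℚ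
sumF {ℕ.suc m} f = f zero + sumF (λ i → f (suc i))

record IsMetric {n : ℕ} (d : Fin n → Fin n → ℚ) : Set where
  field
    refl0    : ∀ x → d x x ≡ 0ℚ
    pos      : ∀ x y → x ≢ y → 0ℚ < d x y
    symm     : ∀ x y → d x y ≡ d y x
    triangle : ∀ x y z → d x z ≤ d x y + d y z

record Instance : Set where
  constructor mkInst
  field
    n    : ℕ
    d    : Fin n → Fin n → ℚ
    root : Fin n
    m    : ℕ
    S    : Fin m → Subset n
    q    : Fin m → ℚ

record Valid (J : Instance) : Set where
  open Instance J
  field
    metric   : IsMetric d
    distinct : Injective _≡_ _≡_ S
    nonneg   : ∀ i → 0ℚ ≤ q i
    sum1     : sumF q ≡ 1ℚ

data DTree (n : ℕ) : Set where
  leaf : DTree n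
  node : Fin n → (yes no : DTree n) → DTree n

-- Run the tree on demand set D: labels of the visited non-leaf nodes (in order),
-- and the address (list of yes/no choices) of the leaf reached.
run : ∀ {n} → DTree n → Subset n → List (Fin n) × List Bool
run leaf D = [] , []
run (node u y no) D with lookup D u
... | true  = let r = run y D  in (u ∷ proj₁ r) , (true ∷ proj₂ r)
... | false = let r = run no D in (u ∷ proj₁ r) , (false ∷ proj₂ r)

tourFrom : ∀ {n} → (Fin n → Fin n → ℚ) → Fin n → Fin n → List (Fin n) → ℚ
tourFrom d r cur []       = d cur r
tourFrom d r cur (x ∷ xs) = d cur x + tourFrom d r x xs

pathLen : ∀ {n} → (Fin n → Fin n → ℚ) → Fin n → DTree n → Subset n → ℚ
pathLen d r T D = tourFrom d r r (proj₁ (run T D))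

RootLabelled : ∀ {n} → Fin n → DTree n → Set
RootLabelled r leaf = Fin 0
RootLabelled r (node u _ _) = u ≡ r

Feasible : (J : Instance) → DTree (Instance.n J) → Set
Feasible J T = RootLabelled root T ×
  (∀ i j → i ≢ j → proj₂ (run T (S i)) ≢ proj₂ (run T (S j)))
  where open Instance J

cost : (J : Instance) → DTree (Instance.n J) → ℚ
cost J T = sumF (λ i → q i * pathLen d root T (S i))
  where open Instance J

IsOptimal : Instance → ℚ → Set
IsOptimal J v = Σ (DTree (Instance.n J)) (λ T → Feasible J T × cost J T ≡ v)
              × (∀ T → Feasible J T → v ≤ cost J T)

-- Partition of M = Fin m into t parts, given by the part index of each scenario.
-- q'_k = Σ_{i ∈ P_k} q_i
blockMass : ∀ {m t} → (Fin m → Fin t) → (Fin m → ℚ) → Fin t → ℚ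
blockMass part q k = sumF (λ i → if ⌊ part i F.≟ k ⌋ then q i else 0ℚ)

block : ∀ {m t} → (Fin m → Fin t) → Fin t → List (Fin m)
block {m} part k = filter (λ i → part i F.≟ k) (L.allFin m)

subInstance : (J : Instance) → ∀ {t} → (part : Fin (Instance.m J) → Fin t) → (k : Fin t)
  → 0ℚ < blockMass part (Instance.q J) k → Instance
subInstance J {t} part k pos =
  mkInst n d root (length (block part k))
    (λ j → S (L.lookup (block part k) j))
    (λ j → q (L.lookup (block part k) j) * inv)
  where
  open Instance J
  q' = blockMass part q k
  inv : ℚ
  inv = (1/ q') {{pos⇒nonZero q' {{positive pos}}}}

-- An optimal tree T for J₀, run only on the scenarios of P_k, still separates them, so it is
-- feasible for J_k; and since J_k rescales probabilities by 1/q'_k, q'_k times its J_k-cost is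
-- exactly the share of T's J₀-cost coming from P_k. Summing over k recovers cost(T) = IsoTime*(J₀).
module Submission where

open import Defs
open import Data.Fin using (Fin)
open import Data.Nat using (ℕ)
open import Data.Rational using (ℚ; 0ℚ; _*_; _≤_; _<_)

open import Algebra.Bundles using (CommutativeMonoid)
import Algebra.Properties.CommutativeSemigroup as CommSemigroupProperties
open import Function using (_∘_; id)
open import Data.Bool using (if_then_else_)
open import Data.Fin using (zero; suc; _≟_)
open import Data.List using (List; []; _∷_; length; filter; tabulate; lookup)
open import Data.List.Membership.Propositional.Properties using (∈-lookup)
import Data.List.Relation.Unary.All as All
open import Data.List.Relation.Unary.AllPairs using (_∷_)
open import Data.List.Relation.Unary.Unique.Propositional using (Unique)
open import Data.List.Relation.Unary.Unique.Propositional.Properties using (filter⁺; allFin⁺)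
open import Data.Product using (_,_; proj₂)
open import Data.Rational using (1ℚ; _+_; 1/_; NonZero; positive; nonNegative)
open import Data.Rational.Properties
  using ( ≤-refl; <⇒≤; +-mono-≤; *-monoˡ-≤-nonNeg; +-identityˡ; +-identityʳ; *-identityʳ
        ; *-zeroʳ; *-assoc; *-distribˡ-+; *-inverseʳ; pos⇒nonZero
        ; +-0-commutativeMonoid; *-1-commutativeMonoid; module ≤-Reasoning )
open import Relation.Binary.PropositionalEquality
open import Relation.Nullary using (yes; no; contradiction)
open import Relation.Nullary.Decidable using (⌊_⌋; ⌊⌋-map′)
open import Relation.Unary using (Pred; Decidable)

open CommSemigroupProperties (CommutativeMonoid.commutativeSemigroup +-0-commutativeMonoid)
  using () renaming (interchange to +-interchange)
open CommSemigroupProperties (CommutativeMonoid.commutativeSemigroup *-1-commutativeMonoid)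
  using () renaming (x∙yz≈y∙xz to *-left-comm)

sumF-cong : ∀ {m} {f g : Fin m → ℚ} → (∀ i → f i ≡ g i) → sumF f ≡ sumF g
sumF-cong {ℕ.zero}  f≡g = refl
sumF-cong {ℕ.suc m} f≡g = cong₂ _+_ (f≡g zero) (sumF-cong (f≡g ∘ suc))

sumF-mono-≤ : ∀ {m} {f g : Fin m → ℚ} → (∀ i → f i ≤ g i) → sumF f ≤ sumF g
sumF-mono-≤ {ℕ.zero}  f≤g = ≤-refl
sumF-mono-≤ {ℕ.suc m} f≤g = +-mono-≤ (f≤g zero) (sumF-mono-≤ (f≤g ∘ suc))

sumF-0 : ∀ m → sumF {m} (λ _ → 0ℚ) ≡ 0ℚ
sumF-0 ℕ.zero    = refl
sumF-0 (ℕ.suc m) = trans (+-identityˡ _) (sumF-0 m)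

sumF-+ : ∀ {m} (f g : Fin m → ℚ) → sumF (λ i → f i + g i) ≡ sumF f + sumF g
sumF-+ {ℕ.zero}  f g = sym (+-identityˡ 0ℚ)
sumF-+ {ℕ.suc m} f g =
  trans (cong (f zero + g zero +_) (sumF-+ (λ i → f (suc i)) (λ i → g (suc i))))
        (+-interchange (f zero) (g zero) _ _)

sumF-*ˡ : ∀ {m} (c : ℚ) (f : Fin m → ℚ) → sumF (λ i → c * f i) ≡ c * sumF f
sumF-*ˡ {ℕ.zero}  c f = sym (*-zeroʳ c)
sumF-*ˡ {ℕ.suc m} c f =
  trans (cong (c * f zero +_) (sumF-*ˡ c (λ i → f (suc i))))
        (sym (*-distribˡ-+ c (f zero) _))

sumF-comm : ∀ {t m} (f : Fin t → Fin m → ℚ) →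
  sumF (λ k → sumF (f k)) ≡ sumF (λ i → sumF (λ k → f k i))
sumF-comm {ℕ.zero}  {m} f = sym (sumF-0 m)
sumF-comm {ℕ.suc t} f =
  trans (cong (sumF (f zero) +_) (sumF-comm (λ k → f (suc k))))
        (sym (sumF-+ (f zero) (λ i → sumF (λ k → f (suc k) i))))

sumF-indicator : ∀ {t} (p : Fin t) (x : ℚ) → sumF (λ k → if ⌊ p ≟ k ⌋ then x else 0ℚ) ≡ x
sumF-indicator {ℕ.suc t} zero    x = trans (cong (x +_) (sumF-0 t)) (+-identityʳ x)
sumF-indicator {ℕ.suc t} (suc p) x = begin
  0ℚ + sumF (λ k → if ⌊ suc p ≟ suc k ⌋ then x else 0ℚ) ≡⟨ +-identityˡ _ ⟩
  sumF (λ k → if ⌊ suc p ≟ suc k ⌋ then x else 0ℚ)      ≡⟨ sumF-cong (λ k → cong (if_then x else 0ℚ) (⌊⌋-map′ _ _ (p ≟ k))) ⟩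
  sumF (λ k → if ⌊ p ≟ k ⌋ then x else 0ℚ)              ≡⟨ sumF-indicator p x ⟩
  x                                                    ∎
  where open ≡-Reasoning

sumL : ∀ {A : Set} → (A → ℚ) → List A → ℚ
sumL g []       = 0ℚ
sumL g (x ∷ xs) = g x + sumL g xs

sumF-lookup : ∀ {A : Set} (g : A → ℚ) (xs : List A) → sumF (λ j → g (lookup xs j)) ≡ sumL g xs
sumF-lookup g []       = refl
sumF-lookup g (x ∷ xs) = cong (g x +_) (sumF-lookup g xs)

sumL-filter-tabulate : ∀ {A : Set} {ℓ} {P : Pred A ℓ} (P? : Decidable P) (g : A → ℚ) {m} (f : Fin m → A) →
  sumL g (filter P? (tabulate f)) ≡ sumF (λ i → if ⌊ P? (f i) ⌋ then g (f i) else 0ℚ)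
sumL-filter-tabulate P? g {ℕ.zero}  f = refl
sumL-filter-tabulate P? g {ℕ.suc m} f with P? (f zero)
... | yes _ = cong (g (f zero) +_) (sumL-filter-tabulate P? g (λ i → f (suc i)))
... | no _  = trans (sumL-filter-tabulate P? g (λ i → f (suc i))) (sym (+-identityˡ _))

lookup-injective : ∀ {A : Set} {xs : List A} → Unique xs → ∀ i j → lookup xs i ≡ lookup xs j → i ≡ j
lookup-injective (_  ∷ _)   zero    zero    _  = refl
lookup-injective (x≢ ∷ _)   zero    (suc j) eq = contradiction eq (All.lookup x≢ (∈-lookup j))
lookup-injective (x≢ ∷ _)   (suc i) zero    eq = contradiction (sym eq) (All.lookup x≢ (∈-lookup i))
lookup-injective (_  ∷ xs!) (suc i) (suc j) eq = cong suc (lookup-injective xs! i j eq)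

module _ {m t} (part : Fin m → Fin t) where

  sumF-block : (g : Fin m → ℚ) (k : Fin t) →
    sumF (λ j → g (lookup (block part k) j)) ≡ blockMass part g k
  sumF-block g k = trans (sumF-lookup g (block part k))
                         (sumL-filter-tabulate (λ i → part i ≟ k) g id)

  sumF-blockMass : (g : Fin m → ℚ) → sumF (blockMass part g) ≡ sumF g
  sumF-blockMass g = trans (sumF-comm (λ k i → if ⌊ part i ≟ k ⌋ then g i else 0ℚ))
                           (sumF-cong (λ i → sumF-indicator (part i) (g i)))

  block-lookup-injective : ∀ k i j → lookup (block part k) i ≡ lookup (block part k) j → i ≡ j
  block-lookup-injective k = lookup-injective (filter⁺ (λ i → part i ≟ k) (allFin⁺ m))

module _ (J : Instance) {t} (part : Fin (Instance.m J) → Fin t) (k : Fin t)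
         (pos : 0ℚ < blockMass part (Instance.q J) k) where

  open Instance J

  subInstance-feasible : ∀ T → Feasible J T → Feasible (subInstance J part k pos) T
  subInstance-feasible T (rooted , separates) =
    rooted , λ i j i≢j → separates _ _ (i≢j ∘ block-lookup-injective part k i j)

  blockMass-*-subInstance-cost : ∀ T →
    blockMass part q k * cost (subInstance J part k pos) T
      ≡ blockMass part (λ i → q i * pathLen d root T (S i)) k
  blockMass-*-subInstance-cost T = begin
      q' * sumF (λ j → (q (b j) * q'⁻¹) * L (b j))  ≡⟨ sumF-*ˡ q' (λ j → (q (b j) * q'⁻¹) * L (b j)) ⟨
      sumF (λ j → q' * ((q (b j) * q'⁻¹) * L (b j))) ≡⟨ sumF-cong (λ j → cancel (q (b j)) (L (b j))) ⟩
      sumF (λ j → q (b j) * L (b j))                 ≡⟨ sumF-block part (λ i → q i * L i) k ⟩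
      blockMass part (λ i → q i * L i) k             ∎
    where
    open ≡-Reasoning
    q' : ℚ
    q' = blockMass part q k
    instance
      q'≢0 : NonZero q'
      q'≢0 = pos⇒nonZero q' {{positive pos}}
    q'⁻¹ : ℚ
    q'⁻¹ = 1/ q'
    b : Fin (length (block part k)) → Fin m
    b = lookup (block part k)
    L : Fin m → ℚ
    L i = pathLen d root T (S i)
    cancel : ∀ a l → q' * ((a * q'⁻¹) * l) ≡ a * l
    cancel a l = begin
      q' * ((a * q'⁻¹) * l)  ≡⟨ *-assoc q' (a * q'⁻¹) l ⟨
      (q' * (a * q'⁻¹)) * l  ≡⟨ cong (_* l) (*-left-comm q' a q'⁻¹) ⟩
      (a * (q' * q'⁻¹)) * l  ≡⟨ cong (λ x → (a * x) * l) (*-inverseʳ q') ⟩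
      (a * 1ℚ) * l           ≡⟨ cong (_* l) (*-identityʳ a) ⟩
      a * l                  ∎

claim4 : (J : Instance) → Valid J
    → (t : ℕ) (part : Fin (Instance.m J) → Fin t)
    → (pos : ∀ k → 0ℚ < blockMass part (Instance.q J) k)
    → (v₀ : ℚ) → IsOptimal J v₀
    → (v : Fin t → ℚ) → (∀ k → IsOptimal (subInstance J part k (pos k)) (v k))
    → sumF (λ k → blockMass part (Instance.q J) k * v k) ≤ v₀
claim4 J _ t part pos v₀ ((T , feasible , cost≡v₀) , _) v optimal = begin
    sumF (λ k → q' k * v k)                               ≤⟨ sumF-mono-≤ q'v≤q'cost ⟩
    sumF (λ k → q' k * cost (subInstance J part k (pos k)) T)
      ≡⟨ sumF-cong (λ k → blockMass-*-subInstance-cost J part k (pos k) T) ⟩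
    sumF (blockMass part h)                               ≡⟨ sumF-blockMass part h ⟩
    cost J T                                              ≡⟨ cost≡v₀ ⟩
    v₀                                                    ∎
  where
  open Instance J
  open ≤-Reasoning
  q' : Fin t → ℚ
  q' = blockMass part q
  h : Fin m → ℚ
  h i = q i * pathLen d root T (S i)
  q'v≤q'cost : ∀ k → q' k * v k ≤ q' k * cost (subInstance J part k (pos k)) T
  q'v≤q'cost k = *-monoˡ-≤-nonNeg (q' k) {{nonNegative (<⇒≤ (pos k))}}
    (proj₂ (optimal k) T (subInstance-feasible J part k (pos k) T feasible))
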